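{- Fix a 3-moding and let a program $P$ and a query $Q$ be well-3-moded. Then: (1) all queries in SLD-derivations of $P$ with $Q$ are well-3-moded; (2) if $Q\theta$ is an answer for $P$ with $Q$, then the input and output positions of $Q\theta$ are ground; (3) for $P$ with $Q$ the Prolog selection rule (leftmost atom) is compatible with moding; (4) if no argument position is moded as output, then every selection rule is compatible with moding for $P$ with $Q$.
   Context: A 3-moding assigns to each argument position of each predicate one of $+$ (input), $-$ (output), $\bot$ (neutral). In a clause $C=H\gets B_1,\ldots,B_m$, a defining occurrence of a variable $V$ is an occurrence of $V$ in an input position of $H$ or in an output position of some $B_i$. $C$ is well-3-moded if each variable in an output position of $H$ has a defining occurrence in $C$, and each occurrence of a variable $V$ in an input position of some $B_j$ is preceded (in the order $H,B_1,\ldots,B_m$) by a defining occurrence of $V$ in another atom of $C$. A query $Q$ is well-3-moded if the clause $p\gets Q$ is (for a nullary predicate $p$). A program is well-3-moded if all its clauses are. An answer for $P$ with $Q$ is $Q\theta$ where $\theta$ is a (correct or computed) answer substitution for $P$ and $Q$. A (possibly partial) selection rule is compatible with moding for $P$ with $Q$ if (i) in each selected atom of the SLD-tree for $P$ with $Q$ the input positions are ground, and (ii) some atom is selected in every nonempty query. -}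

module Defs where

open import Level using (Level; 0ℓ) renaming (suc to lsuc)
open import Data.Nat using (ℕ)
open import Data.Fin using (Fin; toℕ; zero; suc) renaming (_<_ to _<ᶠ_)
open import Data.List using (List; []; _∷_; _++_; length; lookup; take; drop; map; _∷ʳ_)
open import Data.List.Relation.Unary.All using (All)
open import Data.List.Relation.Unary.Any using (Any)
open import Data.List.Membership.Propositional using (_∈_)
open import Data.Maybe using (Maybe; just; nothing)
open import Data.Product using (Σ; _×_; _,_; ∃)
open import Data.Sum using (_⊎_)
open import Relation.Nullary using (¬_)
open import Relation.Binary.PropositionalEquality using (_≡_; _≢_)

data Term : Set where
  var : ℕ → Term
  fn  : ℕ → List Term → Term

record Atom : Set where
  constructor mkAtom
  field
    pred : ℕ
    args : List Term
open Atom public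

Query : Set
Query = List Atom

record Clause : Set where
  constructor _⇐_
  field
    head : Atom
    body : List Atom
open Clause public

Program : Set
Program = List Clause

mutual
  data _∈ᵥ_ (x : ℕ) : Term → Set where
    here : x ∈ᵥ var x
    arg  : ∀ {f ts} → x ∈ᵥs ts → x ∈ᵥ fn f ts

  data _∈ᵥs_ (x : ℕ) : List Term → Set where
    hd : ∀ {t ts} → x ∈ᵥ t → x ∈ᵥs (t ∷ ts)
    tl : ∀ {t ts} → x ∈ᵥs ts → x ∈ᵥs (t ∷ ts)

AtomVar : ℕ → Atom → Set
AtomVar x A = x ∈ᵥs args A

QueryVar : ℕ → Query → Set
QueryVar x Q = Any (AtomVar x) Q

ClauseVar : ℕ → Clause → Set
ClauseVar x c = AtomVar x (head c) ⊎ QueryVar x (body c)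

Subst : Set
Subst = ℕ → Term

mutual
  subT : Subst → Term → Term
  subT σ (var x)   = σ x
  subT σ (fn f ts) = fn f (subTs σ ts)

  subTs : Subst → List Term → List Term
  subTs σ []       = []
  subTs σ (t ∷ ts) = subT σ t ∷ subTs σ ts

subA : Subst → Atom → Atom
subA σ (mkAtom p ts) = mkAtom p (subTs σ ts)

subQ : Subst → Query → Query
subQ σ Q = map (subA σ) Q

subC : Subst → Clause → Clause
subC σ (H ⇐ B) = subA σ H ⇐ subQ σ B

-- variables of a substitution: Var(θ) = Dom(θ) ∪ Ran(θ)
SubstVar : ℕ → Subst → Set
SubstVar x θ = Σ ℕ λ y → θ y ≢ var y × (x ≡ y ⊎ x ∈ᵥ θ y)

-- composition θ₁θ₂⋯θₙ (θ₁ applied first)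
composeAll : List Subst → Subst
composeAll []       = var
composeAll (θ ∷ θs) = λ x → subT (composeAll θs) (θ x)

Unifier : Subst → Atom → Atom → Set
Unifier θ A B = subA θ A ≡ subA θ B

MGU : Subst → Atom → Atom → Set
MGU θ A B = Unifier θ A B ×
  (∀ σ → Unifier σ A B → Σ Subst λ δ → ∀ x → σ x ≡ subT δ (θ x))

Variant : Clause → Clause → Set
Variant c' c = Σ (ℕ → ℕ) λ r → Σ (ℕ → ℕ) λ s →
  (∀ x → s (r x) ≡ x) × (∀ x → r (s x) ≡ x) × (c' ≡ subC (λ x → var (r x)) c)

resolvent : (Q : Query) → Fin (length Q) → Clause → Subst → Query
resolvent Q i c' θ = subQ θ (take (toℕ i) Q ++ body c' ++ drop (Data.Nat.suc (toℕ i)) Q)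

record Step : Set where
  constructor mkStep
  field
    query : Query
    sel   : Fin (length query)
    input : Clause
    mgu   : Subst
open Step public

mgus : List Step → List Subst
mgus = map mgu

StdApart : Query → List Step → Clause → Set
StdApart Q₀ h c' = ∀ x → ClauseVar x c' →
  ¬ QueryVar x Q₀ × All (λ s → ¬ ClauseVar x (input s) × ¬ SubstVar x (mgu s)) h

-- SLD P Q₀ h Q : an initial fragment of an SLD-derivation of P with Q₀, whose
-- steps so far are recorded in h, ending in the query Q
data SLD (P : Program) (Q₀ : Query) : List Step → Query → Set where
  start : SLD P Q₀ [] Q₀
  step  : ∀ {h Q} → SLD P Q₀ h Q →
          (i : Fin (length Q)) (c c' : Clause) (θ : Subst) →
          c ∈ P → Variant c' c → StdApart Q₀ h c' →
          MGU θ (lookup Q i) (head c') →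
          SLD P Q₀ (h ∷ʳ mkStep Q i c' θ) (resolvent Q i c' θ)

PSelRule : Set
PSelRule = List Step → (Q : Query) → Maybe (Fin (length Q))

SelRule : Set
SelRule = List Step → (A : Atom) (Q : Query) → Fin (length (A ∷ Q))

toPartial : SelRule → PSelRule
toPartial R h []      = nothing
toPartial R h (A ∷ Q) = just (R h A Q)

prolog : SelRule
prolog h A Q = zero

-- derivations via a selection rule (= nodes of the SLD-tree)
data Via (R : PSelRule) {P : Program} {Q₀ : Query} : ∀ {h Q} → SLD P Q₀ h Q → Set where
  start : Via R start
  step  : ∀ {h Q} {d : SLD P Q₀ h Q} {i c c' θ} {m v a u} →
          Via R d → R h Q ≡ just i → Via R (step d i c c' θ m v a u)

data Mode : Set where
  In Out Neutral : Mode

Moding : Set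
Moding = ℕ → ℕ → Mode   -- predicate symbol, argument position (0-based)

VarAt : Moding → Mode → Atom → ℕ → Set
VarAt mode m A x = Σ (Fin (length (args A))) λ k →
  mode (pred A) (toℕ k) ≡ m × x ∈ᵥ lookup (args A) k

record WellModedClause (mode : Moding) (c : Clause) : Set where
  field
    outputs : ∀ x → VarAt mode Out (head c) x →
      VarAt mode In (head c) x ⊎ Σ (Fin (length (body c))) λ j → VarAt mode Out (lookup (body c) j) x
    inputs  : ∀ (j : Fin (length (body c))) x → VarAt mode In (lookup (body c) j) x →
      VarAt mode In (head c) x ⊎
      Σ (Fin (length (body c))) λ i → i <ᶠ j × VarAt mode Out (lookup (body c) i) x

-- Q is well-moded iff p ← Q is, p nullary
WellModedQuery : Moding → Query → Set
WellModedQuery mode Q = WellModedClause mode (mkAtom 0 [] ⇐ Q)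

WellModedProgram : Moding → Program → Set
WellModedProgram mode P = All (WellModedClause mode) P

InputsGround : Moding → Atom → Set
InputsGround mode A = ∀ x → ¬ VarAt mode In A x

InOutGround : Moding → Query → Set
InOutGround mode Q = All (λ A → ∀ x → ¬ VarAt mode In A x × ¬ VarAt mode Out A x) Q

record Compatible (mode : Moding) (P : Program) (Q₀ : Query) (R : PSelRule) : Set where
  field
    selectedGround : ∀ {h Q} (d : SLD P Q₀ h Q) → Via R d →
      ∀ i → R h Q ≡ just i → InputsGround mode (lookup Q i)
    selects : ∀ {h A Q} (d : SLD P Q₀ h (A ∷ Q)) → Via R d →
      Σ (Fin (length (A ∷ Q))) λ i → R h (A ∷ Q) ≡ just i

record Interp (D : Set) : Set₁ where
  field
    funI : ℕ → List D → D
    relI : ℕ → List D → Set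
open Interp public

module _ {D : Set} (I : Interp D) (v : ℕ → D) where
  mutual
    evalT : Term → D
    evalT (var x)   = v x
    evalT (fn f ts) = funI I f (evalTs ts)

    evalTs : List Term → List D
    evalTs []       = []
    evalTs (t ∷ ts) = evalT t ∷ evalTs ts

  HoldsA : Atom → Set
  HoldsA A = relI I (pred A) (evalTs (args A))

IsModel : {D : Set} → Interp D → Program → Set
IsModel I P = ∀ {c} → c ∈ P → ∀ v → All (HoldsA I v) (body c) → HoldsA I v (head c)

_⊨∀_ : Program → Query → Set₁
P ⊨∀ Q = ∀ (D : Set) (I : Interp D) → IsModel I P → ∀ v → All (HoldsA I v) Q

ComputedAnswerSubst : Program → Query → Subst → Set
ComputedAnswerSubst P Q θ = Σ (List Step) λ h → SLD P Q h [] ×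
  (∀ x → (QueryVar x Q → θ x ≡ composeAll (mgus h) x) × (¬ QueryVar x Q → θ x ≡ var x))

CorrectAnswerSubst : Program → Query → Subst → Set₁
CorrectAnswerSubst P Q θ = (∀ x → θ x ≢ var x → QueryVar x Q) × (P ⊨∀ subQ θ Q)

{-# OPTIONS --safe #-}
-- In a well-moded query every input variable of an atom is an output variable
-- of an earlier atom. A resolution step replaces the selected atom by a clause
-- body which, once the mgu is applied, is well-moded from the atom's inputs
-- and defines its outputs, so this invariant holds along every derivation; in
-- particular the leftmost atom (and, without outputs, every atom) has ground
-- inputs. For answers, interpret each predicate over terms as "ground inputs
-- imply ground outputs": every well-moded clause is true in this model, and in
-- a well-moded query whose atoms all satisfy it groundness flows from left to
-- right. Computed answers are correct by soundness of SLD-resolution.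
module Submission where

open import Defs
open import Level using (0ℓ)
open import Data.Nat as ℕ using (ℕ; s≤s; z≤n)
open import Data.Fin using (Fin; toℕ; zero; suc) renaming (_<_ to _<ᶠ_)
open import Data.List using (List; []; _∷_; _++_; length; lookup; take; drop; _∷ʳ_)
open import Data.List.Properties using (map-++)
open import Data.List.Relation.Unary.All using (All; []; _∷_)
import Data.List.Relation.Unary.All as All
open import Data.List.Relation.Unary.All.Properties using (++⁺; ++⁻; map⁺; map⁻)
open import Data.List.Relation.Unary.Any using (Any; here; there)
open import Data.List.Membership.Propositional using (_∈_; lose)
open import Data.List.Membership.Propositional.Properties using (∈-lookup)
open import Data.Maybe using (just)
open import Data.Product using (Σ; _×_; _,_; proj₁; proj₂)
open import Data.Sum using (_⊎_; inj₁; inj₂; [_,_])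
import Data.Sum as Sum
open import Data.Unit using (⊤; tt)
open import Function using (_∘_)
open import Relation.Nullary using (¬_)
open import Relation.Unary using (Pred; ∅; _∪_; _⊆_)
open import Relation.Binary.PropositionalEquality
  using (_≡_; _≢_; refl; sym; trans; cong; cong₂; subst; module ≡-Reasoning)

mutual
  ∈ᵥ-subT⁻ : ∀ {x} σ t → x ∈ᵥ subT σ t → Σ ℕ λ y → y ∈ᵥ t × x ∈ᵥ σ y
  ∈ᵥ-subT⁻ σ (var y) x∈σy = y , here , x∈σy
  ∈ᵥ-subT⁻ σ (fn f ts) (arg x∈) with ∈ᵥs-subTs⁻ σ ts x∈
  ... | y , y∈ts , x∈σy = y , arg y∈ts , x∈σy

  ∈ᵥs-subTs⁻ : ∀ {x} σ ts → x ∈ᵥs subTs σ ts → Σ ℕ λ y → y ∈ᵥs ts × x ∈ᵥ σ y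
  ∈ᵥs-subTs⁻ σ (t ∷ ts) (hd x∈) with ∈ᵥ-subT⁻ σ t x∈
  ... | y , y∈t , x∈σy = y , hd y∈t , x∈σy
  ∈ᵥs-subTs⁻ σ (t ∷ ts) (tl x∈) with ∈ᵥs-subTs⁻ σ ts x∈
  ... | y , y∈ts , x∈σy = y , tl y∈ts , x∈σy

mutual
  ∈ᵥ-subT⁺ : ∀ {x y} σ t → y ∈ᵥ t → x ∈ᵥ σ y → x ∈ᵥ subT σ t
  ∈ᵥ-subT⁺ σ (var y) here x∈σy = x∈σy
  ∈ᵥ-subT⁺ σ (fn f ts) (arg y∈) x∈σy = arg (∈ᵥs-subTs⁺ σ ts y∈ x∈σy)

  ∈ᵥs-subTs⁺ : ∀ {x y} σ ts → y ∈ᵥs ts → x ∈ᵥ σ y → x ∈ᵥs subTs σ ts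
  ∈ᵥs-subTs⁺ σ (t ∷ ts) (hd y∈) x∈σy = hd (∈ᵥ-subT⁺ σ t y∈ x∈σy)
  ∈ᵥs-subTs⁺ σ (t ∷ ts) (tl y∈) x∈σy = tl (∈ᵥs-subTs⁺ σ ts y∈ x∈σy)

mutual
  subT-var : ∀ t → subT var t ≡ t
  subT-var (var x) = refl
  subT-var (fn f ts) = cong (fn f) (subTs-var ts)

  subTs-var : ∀ ts → subTs var ts ≡ ts
  subTs-var [] = refl
  subTs-var (t ∷ ts) = cong₂ _∷_ (subT-var t) (subTs-var ts)

subA-var : ∀ A → subA var A ≡ A
subA-var A = cong (mkAtom (pred A)) (subTs-var (args A))

subQ-var : ∀ Q → subQ var Q ≡ Q
subQ-var [] = refl
subQ-var (A ∷ Q) = cong₂ _∷_ (subA-var A) (subQ-var Q)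

mutual
  subT-∘ : ∀ σ τ t → subT σ (subT τ t) ≡ subT (subT σ ∘ τ) t
  subT-∘ σ τ (var x) = refl
  subT-∘ σ τ (fn f ts) = cong (fn f) (subTs-∘ σ τ ts)

  subTs-∘ : ∀ σ τ ts → subTs σ (subTs τ ts) ≡ subTs (subT σ ∘ τ) ts
  subTs-∘ σ τ [] = refl
  subTs-∘ σ τ (t ∷ ts) = cong₂ _∷_ (subT-∘ σ τ t) (subTs-∘ σ τ ts)

subQ-∘ : ∀ σ τ Q → subQ σ (subQ τ Q) ≡ subQ (subT σ ∘ τ) Q
subQ-∘ σ τ [] = refl
subQ-∘ σ τ (A ∷ Q) = cong₂ _∷_ (cong (mkAtom (pred A)) (subTs-∘ σ τ (args A))) (subQ-∘ σ τ Q)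

mutual
  subT-cong : ∀ {σ τ} t → (∀ x → x ∈ᵥ t → σ x ≡ τ x) → subT σ t ≡ subT τ t
  subT-cong (var x) σ≗τ = σ≗τ x here
  subT-cong (fn f ts) σ≗τ = cong (fn f) (subTs-cong ts (λ x → σ≗τ x ∘ arg))

  subTs-cong : ∀ {σ τ} ts → (∀ x → x ∈ᵥs ts → σ x ≡ τ x) → subTs σ ts ≡ subTs τ ts
  subTs-cong [] σ≗τ = refl
  subTs-cong (t ∷ ts) σ≗τ =
    cong₂ _∷_ (subT-cong t (λ x → σ≗τ x ∘ hd)) (subTs-cong ts (λ x → σ≗τ x ∘ tl))

subQ-cong : ∀ {σ τ} Q → (∀ x → QueryVar x Q → σ x ≡ τ x) → subQ σ Q ≡ subQ τ Q
subQ-cong [] σ≗τ = refl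
subQ-cong (A ∷ Q) σ≗τ =
  cong₂ _∷_ (cong (mkAtom (pred A)) (subTs-cong (args A) (λ x → σ≗τ x ∘ here)))
            (subQ-cong Q (λ x → σ≗τ x ∘ there))

composeAll-∷ʳ : ∀ θs θ x → composeAll (θs ∷ʳ θ) x ≡ subT θ (composeAll θs x)
composeAll-∷ʳ [] θ x = subT-var (θ x)
composeAll-∷ʳ (τ ∷ θs) θ x = begin
  subT (composeAll (θs ∷ʳ θ)) (τ x)   ≡⟨ subT-cong (τ x) (λ y _ → composeAll-∷ʳ θs θ y) ⟩
  subT (subT θ ∘ composeAll θs) (τ x) ≡⟨ sym (subT-∘ θ (composeAll θs) (τ x)) ⟩
  subT θ (subT (composeAll θs) (τ x)) ∎
  where open ≡-Reasoning

subQ-composeAll-∷ʳ : ∀ h s Q →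
  subQ (composeAll (mgus (h ∷ʳ s))) Q ≡ subQ (mgu s) (subQ (composeAll (mgus h)) Q)
subQ-composeAll-∷ʳ h s Q = begin
  subQ (composeAll (mgus (h ∷ʳ s))) Q        ≡⟨ cong (λ θs → subQ (composeAll θs) Q) (map-++ mgu h _) ⟩
  subQ (composeAll (mgus h ∷ʳ mgu s)) Q      ≡⟨ subQ-cong Q (λ x _ → composeAll-∷ʳ (mgus h) (mgu s) x) ⟩
  subQ (subT (mgu s) ∘ composeAll (mgus h)) Q ≡⟨ sym (subQ-∘ (mgu s) (composeAll (mgus h)) Q) ⟩
  subQ (mgu s) (subQ (composeAll (mgus h)) Q) ∎
  where open ≡-Reasoning

take++lookup∷drop : ∀ (Q : Query) i → take (toℕ i) Q ++ lookup Q i ∷ drop (ℕ.suc (toℕ i)) Q ≡ Q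
take++lookup∷drop (A ∷ Q) zero = refl
take++lookup∷drop (A ∷ Q) (suc i) = cong (A ∷_) (take++lookup∷drop Q i)

-- Soundness of SLD-resolution

module _ {D : Set} (I : Interp D) where

  mutual
    evalT-subT : ∀ v σ t → evalT I v (subT σ t) ≡ evalT I (evalT I v ∘ σ) t
    evalT-subT v σ (var x) = refl
    evalT-subT v σ (fn f ts) = cong (funI I f) (evalTs-subTs v σ ts)

    evalTs-subTs : ∀ v σ ts → evalTs I v (subTs σ ts) ≡ evalTs I (evalT I v ∘ σ) ts
    evalTs-subTs v σ [] = refl
    evalTs-subTs v σ (t ∷ ts) = cong₂ _∷_ (evalT-subT v σ t) (evalTs-subTs v σ ts)

  HoldsA-subA⁻ : ∀ v σ A → HoldsA I v (subA σ A) → HoldsA I (evalT I v ∘ σ) A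
  HoldsA-subA⁻ v σ A = subst (relI I (pred A)) (evalTs-subTs v σ (args A))

  HoldsA-subA⁺ : ∀ v σ A → HoldsA I (evalT I v ∘ σ) A → HoldsA I v (subA σ A)
  HoldsA-subA⁺ v σ A = subst (relI I (pred A)) (sym (evalTs-subTs v σ (args A)))

  All-HoldsA-subQ⁻ : ∀ v σ Q → All (HoldsA I v) (subQ σ Q) → All (HoldsA I (evalT I v ∘ σ)) Q
  All-HoldsA-subQ⁻ v σ Q = All.map (λ {A} → HoldsA-subA⁻ v σ A) ∘ map⁻

  All-HoldsA-subQ⁺ : ∀ v σ Q → All (HoldsA I (evalT I v ∘ σ)) Q → All (HoldsA I v) (subQ σ Q)
  All-HoldsA-subQ⁺ v σ Q = map⁺ ∘ All.map (λ {A} → HoldsA-subA⁺ v σ A)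

  IsModel-variant : ∀ {P c c'} → IsModel I P → c ∈ P → Variant c' c →
    ∀ v → All (HoldsA I v) (body c') → HoldsA I v (head c')
  IsModel-variant {c = c} M c∈P (r , _ , _ , _ , refl) v holds =
    HoldsA-subA⁺ v ρ (head c) (M c∈P _ (All-HoldsA-subQ⁻ v ρ (body c) holds))
    where ρ = var ∘ r

  resolvent-sound : ∀ {P Q i c c' θ} → IsModel I P → c ∈ P → Variant c' c →
    Unifier θ (lookup Q i) (head c') →
    ∀ v → All (HoldsA I v) (resolvent Q i c' θ) → All (HoldsA I (evalT I v ∘ θ)) Q
  resolvent-sound {Q = Q} {i} {c' = c'} {θ} M c∈P c'≈c unifies v holds =
    subst (All (HoldsA I w)) (take++lookup∷drop Q i) (++⁺ holdsBefore (selected ∷ holdsAfter))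
    where
      w = evalT I v ∘ θ
      split = ++⁻ (take (toℕ i) Q) (All-HoldsA-subQ⁻ v θ _ holds)
      holdsBefore = proj₁ split
      holdsBody = proj₁ (++⁻ (body c') (proj₂ split))
      holdsAfter = proj₂ (++⁻ (body c') (proj₂ split))
      selected : HoldsA I w (lookup Q i)
      selected = HoldsA-subA⁻ v θ (lookup Q i) (subst (HoldsA I v) (sym unifies)
                   (HoldsA-subA⁺ v θ (head c') (IsModel-variant M c∈P c'≈c w holdsBody)))

  sld-sound : ∀ {P Q₀} → IsModel I P → ∀ {h Q} → SLD P Q₀ h Q →
    ∀ v → All (HoldsA I v) Q → All (HoldsA I v) (subQ (composeAll (mgus h)) Q₀)
  sld-sound {Q₀ = Q₀} M start v holds = subst (All (HoldsA I v)) (sym (subQ-var Q₀)) holds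
  sld-sound {Q₀ = Q₀} M (step {h} d i c c' θ c∈P c'≈c _ (unifies , _)) v holds =
    subst (All (HoldsA I v)) (sym (subQ-composeAll-∷ʳ h _ Q₀))
      (All-HoldsA-subQ⁺ v θ _ (sld-sound M d _ (resolvent-sound M c∈P c'≈c unifies v holds)))

computedAnswer-correct : ∀ {P Q θ} → ComputedAnswerSubst P Q θ → P ⊨∀ subQ θ Q
computedAnswer-correct {Q = Q} (h , d , θ≈γ) D I M v =
  subst (All (HoldsA I v)) (subQ-cong Q (λ x x∈Q → sym (proj₁ (θ≈γ x) x∈Q))) (sld-sound I M d v [])

herbrand : (ℕ → List Term → Set) → Interp Term
herbrand R = record { funI = fn ; relI = R }

mutual
  evalT-herbrand : ∀ R v t → evalT (herbrand R) v t ≡ subT v t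
  evalT-herbrand R v (var x) = refl
  evalT-herbrand R v (fn f ts) = cong (fn f) (evalTs-herbrand R v ts)

  evalTs-herbrand : ∀ R v ts → evalTs (herbrand R) v ts ≡ subTs v ts
  evalTs-herbrand R v [] = refl
  evalTs-herbrand R v (t ∷ ts) = cong₂ _∷_ (evalT-herbrand R v t) (evalTs-herbrand R v ts)

HoldsA-herbrand : ∀ R v A → HoldsA (herbrand R) v A → R (pred A) (subTs v (args A))
HoldsA-herbrand R v A = subst (R (pred A)) (evalTs-herbrand R v (args A))

HoldsA-herbrand⁺ : ∀ R v A → R (pred A) (subTs v (args A)) → HoldsA (herbrand R) v A
HoldsA-herbrand⁺ R v A = subst (R (pred A)) (sym (evalTs-herbrand R v (args A)))

ArgVar : (ℕ → Mode) → Mode → List Term → Pred ℕ 0ℓ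
ArgVar md m ts x = Σ (Fin (length ts)) λ k → md (toℕ k) ≡ m × x ∈ᵥ lookup ts k

ArgVar-subTs⁻ : ∀ md m σ ts {x} → ArgVar md m (subTs σ ts) x → Σ ℕ λ y → ArgVar md m ts y × x ∈ᵥ σ y
ArgVar-subTs⁻ md m σ (t ∷ ts) (zero , mk , x∈) with ∈ᵥ-subT⁻ σ t x∈
... | y , y∈t , x∈σy = y , (zero , mk , y∈t) , x∈σy
ArgVar-subTs⁻ md m σ (t ∷ ts) (suc k , mk , x∈) with ArgVar-subTs⁻ (md ∘ ℕ.suc) m σ ts (k , mk , x∈)
... | y , (k' , mk' , y∈) , x∈σy = y , (suc k' , mk' , y∈) , x∈σy

ArgVar-subTs⁺ : ∀ md m σ ts {x y} → ArgVar md m ts y → x ∈ᵥ σ y → ArgVar md m (subTs σ ts) x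
ArgVar-subTs⁺ md m σ (t ∷ ts) (zero , mk , y∈) x∈σy = zero , mk , ∈ᵥ-subT⁺ σ t y∈ x∈σy
ArgVar-subTs⁺ md m σ (t ∷ ts) (suc k , mk , y∈) x∈σy
  with ArgVar-subTs⁺ (md ∘ ℕ.suc) m σ ts (k , mk , y∈) x∈σy
... | k' , mk' , x∈ = suc k' , mk' , x∈

-- Well-modedness relative to a set of defined variables

module Moded (mode : Moding) where

  InVar OutVar : Atom → Pred ℕ 0ℓ
  InVar A = VarAt mode In A
  OutVar A = VarAt mode Out A

  OutVars : Query → Pred ℕ 0ℓ
  OutVars Q x = Any (λ A → OutVar A x) Q

  _[_] : Pred ℕ 0ℓ → Subst → Pred ℕ 0ℓ
  (D [ σ ]) x = Σ ℕ λ y → D y × x ∈ᵥ σ y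

  -- the variables in D count as defined before the query starts
  WellModedFrom : Pred ℕ 0ℓ → Query → Set
  WellModedFrom D [] = ⊤
  WellModedFrom D (A ∷ Q) = InVar A ⊆ D × WellModedFrom (D ∪ OutVar A) Q

  WellModedClause′ : Clause → Set
  WellModedClause′ c =
    WellModedFrom (InVar (head c)) (body c) × OutVar (head c) ⊆ InVar (head c) ∪ OutVars (body c)

  WellModedIndexed : Pred ℕ 0ℓ → Query → Set
  WellModedIndexed D Q = ∀ (j : Fin (length Q)) x → InVar (lookup Q j) x →
    D x ⊎ Σ (Fin (length Q)) λ i → i <ᶠ j × OutVar (lookup Q i) x

  WellModedFrom-mono : ∀ {D E} Q → D ⊆ E → WellModedFrom D Q → WellModedFrom E Q
  WellModedFrom-mono [] D⊆E _ = tt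
  WellModedFrom-mono (A ∷ Q) D⊆E (ins , wm) = D⊆E ∘ ins , WellModedFrom-mono Q (Sum.map₁ D⊆E) wm

  OutVars-∷⁺ : ∀ {D : Pred ℕ 0ℓ} A Q → (D ∪ OutVar A) ∪ OutVars Q ⊆ D ∪ OutVars (A ∷ Q)
  OutVars-∷⁺ A Q (inj₁ (inj₁ d)) = inj₁ d
  OutVars-∷⁺ A Q (inj₁ (inj₂ o)) = inj₂ (here o)
  OutVars-∷⁺ A Q (inj₂ o) = inj₂ (there o)

  OutVars-∷⁻ : ∀ {D : Pred ℕ 0ℓ} A Q → D ∪ OutVars (A ∷ Q) ⊆ (D ∪ OutVar A) ∪ OutVars Q
  OutVars-∷⁻ A Q (inj₁ d) = inj₁ (inj₁ d)
  OutVars-∷⁻ A Q (inj₂ (here o)) = inj₁ (inj₂ o)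
  OutVars-∷⁻ A Q (inj₂ (there o)) = inj₂ o

  WellModedFrom-++⁻ : ∀ {D} Q₁ Q₂ → WellModedFrom D (Q₁ ++ Q₂) →
    WellModedFrom D Q₁ × WellModedFrom (D ∪ OutVars Q₁) Q₂
  WellModedFrom-++⁻ [] Q₂ wm = tt , WellModedFrom-mono Q₂ inj₁ wm
  WellModedFrom-++⁻ {D} (A ∷ Q₁) Q₂ (ins , wm) with WellModedFrom-++⁻ Q₁ Q₂ wm
  ... | wm₁ , wm₂ = (ins , wm₁) , WellModedFrom-mono Q₂ (OutVars-∷⁺ {D} A Q₁) wm₂

  WellModedFrom-++⁺ : ∀ {D} Q₁ Q₂ → WellModedFrom D Q₁ → WellModedFrom (D ∪ OutVars Q₁) Q₂ →
    WellModedFrom D (Q₁ ++ Q₂)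
  WellModedFrom-++⁺ [] Q₂ _ wm₂ = WellModedFrom-mono Q₂ [ (λ d → d) , (λ ()) ] wm₂
  WellModedFrom-++⁺ {D} (A ∷ Q₁) Q₂ (ins , wm₁) wm₂ =
    ins , WellModedFrom-++⁺ Q₁ Q₂ wm₁ (WellModedFrom-mono Q₂ (OutVars-∷⁻ {D} A Q₁) wm₂)

  WellModedFrom-resolve : ∀ {D} Q₁ A Q₂ B → WellModedFrom D (Q₁ ++ A ∷ Q₂) →
    WellModedClause′ (A ⇐ B) → WellModedFrom D (Q₁ ++ B ++ Q₂)
  WellModedFrom-resolve {D} Q₁ A Q₂ B wm (wmB , outsA) =
    WellModedFrom-++⁺ Q₁ (B ++ Q₂) wm₁
      (WellModedFrom-++⁺ B Q₂ (WellModedFrom-mono B insA wmB) (WellModedFrom-mono Q₂ outsDefined wm₂))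
    where
      split = WellModedFrom-++⁻ Q₁ (A ∷ Q₂) wm
      wm₁ = proj₁ split
      insA = proj₁ (proj₂ split)
      wm₂ = proj₂ (proj₂ split)
      outsDefined : (D ∪ OutVars Q₁) ∪ OutVar A ⊆ (D ∪ OutVars Q₁) ∪ OutVars B
      outsDefined (inj₁ d) = inj₁ d
      outsDefined (inj₂ o) = Sum.map₁ insA (outsA o)

  indexed⇒WellModedFrom : ∀ {D} Q → WellModedIndexed D Q → WellModedFrom D Q
  indexed⇒WellModedFrom [] _ = tt
  indexed⇒WellModedFrom {D} (A ∷ Q) wm = insA , indexed⇒WellModedFrom Q wmQ
    where
      insA : InVar A ⊆ D
      insA {x} p with wm zero x p
      ... | inj₁ d = d
      wmQ : WellModedIndexed (D ∪ OutVar A) Q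
      wmQ j x p with wm (suc j) x p
      ... | inj₁ d = inj₁ (inj₁ d)
      ... | inj₂ (zero , _ , o) = inj₁ (inj₂ o)
      ... | inj₂ (suc i , s≤s i<j , o) = inj₂ (i , i<j , o)

  WellModedFrom⇒indexed : ∀ {D} Q → WellModedFrom D Q → WellModedIndexed D Q
  WellModedFrom⇒indexed (A ∷ Q) (ins , wm) zero x p = inj₁ (ins p)
  WellModedFrom⇒indexed (A ∷ Q) (ins , wm) (suc j) x p with WellModedFrom⇒indexed Q wm j x p
  ... | inj₁ (inj₁ d) = inj₁ d
  ... | inj₁ (inj₂ o) = inj₂ (zero , s≤s z≤n , o)
  ... | inj₂ (i , i<j , o) = inj₂ (suc i , s≤s i<j , o)

  wellModedClause⇒′ : ∀ c → WellModedClause mode c → WellModedClause′ c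
  wellModedClause⇒′ c wm =
    indexed⇒WellModedFrom (body c) (WellModedClause.inputs wm) ,
    λ {x} o → Sum.map₂ (λ (j , o′) → lose (∈-lookup j) o′) (WellModedClause.outputs wm x o)

  wellModedQuery⇒ : ∀ Q → WellModedQuery mode Q → WellModedFrom ∅ Q
  wellModedQuery⇒ Q wm = WellModedFrom-mono Q (λ ()) (indexed⇒WellModedFrom Q (WellModedClause.inputs wm))

  ⇒wellModedQuery : ∀ Q → WellModedFrom ∅ Q → WellModedQuery mode Q
  ⇒wellModedQuery Q wm = record
    { outputs = λ { x (() , _) }
    ; inputs  = WellModedFrom⇒indexed Q (WellModedFrom-mono Q (λ ()) wm)
    }

  InVar-subA⁻ : ∀ σ A → InVar (subA σ A) ⊆ InVar A [ σ ]
  InVar-subA⁻ σ A = ArgVar-subTs⁻ (mode (pred A)) In σ (args A)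

  VarAt-subA⁺ : ∀ m σ A {x y} → VarAt mode m A y → x ∈ᵥ σ y → VarAt mode m (subA σ A) x
  VarAt-subA⁺ m σ A = ArgVar-subTs⁺ (mode (pred A)) m σ (args A)

  OutVars-subQ⁺ : ∀ σ Q {x y} → OutVars Q y → x ∈ᵥ σ y → OutVars (subQ σ Q) x
  OutVars-subQ⁺ σ (A ∷ Q) (here o) x∈σy = here (VarAt-subA⁺ Out σ A o x∈σy)
  OutVars-subQ⁺ σ (A ∷ Q) (there o) x∈σy = there (OutVars-subQ⁺ σ Q o x∈σy)

  WellModedFrom-subQ : ∀ {D} σ Q → WellModedFrom D Q → WellModedFrom (D [ σ ]) (subQ σ Q)
  WellModedFrom-subQ σ [] _ = tt
  WellModedFrom-subQ {D} σ (A ∷ Q) (ins , wm) =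
    insσ , WellModedFrom-mono (subQ σ Q) definedσ (WellModedFrom-subQ σ Q wm)
    where
      insσ : InVar (subA σ A) ⊆ D [ σ ]
      insσ p with InVar-subA⁻ σ A p
      ... | y , q , x∈σy = y , ins q , x∈σy
      definedσ : (D ∪ OutVar A) [ σ ] ⊆ D [ σ ] ∪ OutVar (subA σ A)
      definedσ (y , inj₁ d , x∈σy) = inj₁ (y , d , x∈σy)
      definedσ (y , inj₂ o , x∈σy) = inj₂ (VarAt-subA⁺ Out σ A o x∈σy)

  WellModedClause′-subC : ∀ σ c → WellModedClause′ c → WellModedClause′ (subC σ c)
  WellModedClause′-subC σ c (wm , outs) =
    WellModedFrom-mono (subQ σ (body c)) insσ (WellModedFrom-subQ σ (body c) wm) , outsσ
    where
      insσ : InVar (head c) [ σ ] ⊆ InVar (subA σ (head c))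
      insσ (y , i , x∈σy) = VarAt-subA⁺ In σ (head c) i x∈σy
      outsσ : OutVar (subA σ (head c)) ⊆ InVar (subA σ (head c)) ∪ OutVars (subQ σ (body c))
      outsσ p with ArgVar-subTs⁻ (mode (pred (head c))) Out σ (args (head c)) p
      ... | y , o , x∈σy =
        Sum.map (λ i → VarAt-subA⁺ In σ (head c) i x∈σy) (λ os → OutVars-subQ⁺ σ (body c) os x∈σy) (outs o)

  WellModedFrom∅-subQ : ∀ σ Q → WellModedFrom ∅ Q → WellModedFrom ∅ (subQ σ Q)
  WellModedFrom∅-subQ σ Q wm = WellModedFrom-mono (subQ σ Q) (λ ()) (WellModedFrom-subQ σ Q wm)

  resolvent-wellModed : ∀ Q i c' θ → WellModedFrom ∅ Q → WellModedClause′ c' →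
    Unifier θ (lookup Q i) (head c') → WellModedFrom ∅ (resolvent Q i c' θ)
  resolvent-wellModed Q i c' θ wmQ wmc' unifies =
    subst (WellModedFrom ∅) (sym (subQ-++-++ before (body c') after))
      (WellModedFrom-resolve (subQ θ before) (subA θ (lookup Q i)) (subQ θ after) (subQ θ (body c'))
        wmQθ wmClause)
    where
      before = take (toℕ i) Q
      after = drop (ℕ.suc (toℕ i)) Q
      subQ-++-++ : ∀ Q₁ Q₂ Q₃ → subQ θ (Q₁ ++ Q₂ ++ Q₃) ≡ subQ θ Q₁ ++ subQ θ Q₂ ++ subQ θ Q₃
      subQ-++-++ Q₁ Q₂ Q₃ = trans (map-++ (subA θ) Q₁ _) (cong (subQ θ Q₁ ++_) (map-++ (subA θ) Q₂ Q₃))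
      wmQθ : WellModedFrom ∅ (subQ θ before ++ subA θ (lookup Q i) ∷ subQ θ after)
      wmQθ = subst (WellModedFrom ∅) (map-++ (subA θ) before _)
               (subst (WellModedFrom ∅ ∘ subQ θ) (sym (take++lookup∷drop Q i)) (WellModedFrom∅-subQ θ Q wmQ))
      wmClause : WellModedClause′ (subA θ (lookup Q i) ⇐ subQ θ (body c'))
      wmClause = subst (λ A → WellModedClause′ (A ⇐ subQ θ (body c'))) (sym unifies)
                   (WellModedClause′-subC θ c' wmc')

  sld-wellModed : ∀ {P Q₀} → WellModedProgram mode P → WellModedFrom ∅ Q₀ →
    ∀ {h Q} → SLD P Q₀ h Q → WellModedFrom ∅ Q
  sld-wellModed wmP wmQ₀ start = wmQ₀
  sld-wellModed wmP wmQ₀ (step {Q = Q} d i c c' θ c∈P (r , _ , _ , _ , refl) _ (unifies , _)) =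
    resolvent-wellModed Q i c' θ (sld-wellModed wmP wmQ₀ d)
      (WellModedClause′-subC (var ∘ r) c (wellModedClause⇒′ c (All.lookup wmP c∈P))) unifies

  prolog-compatible : ∀ {P Q₀} → WellModedProgram mode P → WellModedFrom ∅ Q₀ →
    Compatible mode P Q₀ (toPartial prolog)
  prolog-compatible {P} {Q₀} wmP wmQ₀ = record
    { selectedGround = leftmostGround
    ; selects        = λ _ _ → zero , refl
    }
    where
      leftmostGround : ∀ {h Q} (d : SLD P Q₀ h Q) → Via (toPartial prolog) d →
        ∀ i → toPartial prolog h Q ≡ just i → InputsGround mode (lookup Q i)
      leftmostGround {Q = A ∷ Q} d _ .zero refl x = proj₁ (sld-wellModed wmP wmQ₀ d)

  -- with no output positions nothing is ever defined, so all inputs are ground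
  noOutputs-compatible : ∀ {P Q₀} → (∀ p k → mode p k ≢ Out) → WellModedProgram mode P →
    WellModedFrom ∅ Q₀ → ∀ R → Compatible mode P Q₀ (toPartial R)
  noOutputs-compatible {P} {Q₀} noOut wmP wmQ₀ R = record
    { selectedGround = inputsGround
    ; selects        = λ {h} {A} {Q} _ _ → R h A Q , refl
    }
    where
      inputsGround : ∀ {h Q} (d : SLD P Q₀ h Q) → Via (toPartial R) d →
        ∀ i → toPartial R h Q ≡ just i → InputsGround mode (lookup Q i)
      inputsGround {Q = Q} d _ i _ x p with WellModedFrom⇒indexed Q (sld-wellModed wmP wmQ₀ d) i x p
      ... | inj₁ ()
      ... | inj₂ (_ , _ , (_ , isOut , _)) = noOut _ _ isOut

  -- Groundness of answers

  Ground : Mode → Atom → Set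
  Ground m A = ∀ x → ¬ VarAt mode m A x

  PropagatesGround : Atom → Set
  PropagatesGround A = Ground In A → Ground Out A

  wellModed-ground : ∀ {D} Q → D ⊆ ∅ → WellModedFrom D Q → All PropagatesGround Q → InOutGround mode Q
  wellModed-ground [] _ _ _ = []
  wellModed-ground {D} (A ∷ Q) D⊆∅ (ins , wm) (propagates ∷ propagatesQ) =
    (λ x → inGround x , outGround x) ∷ wellModed-ground Q [ D⊆∅ , (λ o → outGround _ o) ] wm propagatesQ
    where
      inGround : Ground In A
      inGround x p = D⊆∅ (ins p)
      outGround : Ground Out A
      outGround = propagates inGround

  OutVars-ground : ∀ Q → InOutGround mode Q → OutVars Q ⊆ ∅
  OutVars-ground Q ground o with All.lookupAny ground o
  ... | grounded , out = proj₂ (grounded _) out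

  clause-propagatesGround : ∀ c → WellModedClause′ c → All PropagatesGround (body c) →
    PropagatesGround (head c)
  clause-propagatesGround c (wm , outs) propagates inGround x o with outs o
  ... | inj₁ i = inGround x i
  ... | inj₂ os = OutVars-ground (body c) (wellModed-ground (body c) (inGround _) wm propagates) os

  propagatesGroundRel : ℕ → List Term → Set
  propagatesGroundRel p ts = PropagatesGround (mkAtom p ts)

  groundingInterp : Interp Term
  groundingInterp = herbrand propagatesGroundRel

  groundingInterp-model : ∀ {P} → WellModedProgram mode P → IsModel groundingInterp P
  groundingInterp-model wmP {c} c∈P v holds =
    HoldsA-herbrand⁺ propagatesGroundRel v (head c)
      (clause-propagatesGround (subC v c) (WellModedClause′-subC v c (wellModedClause⇒′ c (All.lookup wmP c∈P)))
        (map⁺ (All.map (λ {A} → HoldsA-herbrand propagatesGroundRel v A) holds)))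

  correctInstance-ground : ∀ {P} Q θ → WellModedProgram mode P → WellModedFrom ∅ Q →
    P ⊨∀ subQ θ Q → InOutGround mode (subQ θ Q)
  correctInstance-ground Q θ wmP wmQ valid =
    wellModed-ground (subQ θ Q) (λ ()) (WellModedFrom∅-subQ θ Q wmQ)
      (All.map (λ {A} → subst PropagatesGround (subA-var A) ∘ HoldsA-herbrand propagatesGroundRel var A)
        (valid Term groundingInterp (groundingInterp-model wmP) var))

open Moded

lemma19 : ∀ (mode : Moding) (P : Program) (Q : Query) →
    WellModedProgram mode P → WellModedQuery mode Q →
    (∀ {h Q'} → SLD P Q h Q' → WellModedQuery mode Q')
    × (∀ θ → ComputedAnswerSubst P Q θ ⊎ CorrectAnswerSubst P Q θ → InOutGround mode (subQ θ Q))
    × Compatible mode P Q (toPartial prolog)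
    × ((∀ p k → mode p k ≢ Out) → ∀ (R : SelRule) → Compatible mode P Q (toPartial R))
lemma19 mode P Q wmP wmQ =
    (λ d → ⇒wellModedQuery mode _ (sld-wellModed mode wmP wmQ∅ d))
  , (λ θ → correctInstance-ground mode Q θ wmP wmQ∅ ∘ [ computedAnswer-correct , proj₂ ])
  , prolog-compatible mode wmP wmQ∅
  , (λ noOut → noOutputs-compatible mode noOut wmP wmQ∅)
  where
    wmQ∅ = wellModedQuery⇒ mode Q wmQ
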